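{- Every linear expectation $h\in\mathsf{LinExp}$ can effectively be transformed into a linear expectation $\mathrm{GNF}(h)\in\mathsf{LinExp}$ in guarded normal form such that $\mathrm{GNF}(h)\equiv h$.
   Context: Program variables form a finite set $\mathsf{Vars}$; a state is a map $\sigma\colon\mathsf{Vars}\to\mathbb{N}$. Linear expressions: $e::= r\mid x\mid r\cdot e\mid e+e\mid e\mathbin{\dot- }e$ with $r\in\mathbb{Q}_{\ge0}$, $x\in\mathsf{Vars}$, where $\dot-$ is subtraction truncated at $0$. Extended linear expressions: $\tilde e::= e\mid\infty$. Linear guards: $\varphi::= e<e\mid\varphi\wedge\varphi\mid\neg\varphi$ (with $e$ linear expressions, no $\infty$). Linear expectations: $h::=\tilde e\mid[\varphi]\cdot h\mid h+h$, evaluated on states pointwise with $[\varphi](\sigma)\in\{0,1\}$ the truth value of $\varphi$, $0\cdot\infty=0$ and $a+\infty=\infty$. $h\equiv h'$ means $h(\sigma)=h'(\sigma)$ for all states $\sigma$. A linear expectation $h$ is in guarded normal form if $h=\sum_{i=1}^n[\varphi_i]\cdot\tilde e_i$ for some $n\in\mathbb{N}$, extended linear expressions $\tilde e_i$ and linear guards $\varphi_i$ such that for every state $\sigma$ exactly one $i\in\{1,\dots,n\}$ has $\varphi_i(\sigma)=\mathsf{true}$. -}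

module Defs where

open import Data.Nat using (ℕ; suc)
open import Data.Fin using (Fin)
open import Data.Bool using (Bool; true; false; if_then_else_; _∧_; not)
open import Data.Rational using (ℚ; 0ℚ; _≤_; _+_; _-_; _*_; _⊔_; _/_)
open import Data.Rational.Properties using (_<?_)
import Data.Integer
open import Data.Vec using (Vec; lookup; _∷_; [])
open import Data.Product using (Σ; _×_; ∃-syntax; _,_; proj₁)
open import Relation.Nullary using (does)
open import Relation.Binary.PropositionalEquality using (_≡_)

State : ℕ → Set
State k = Fin k → ℕ

data LExp (k : ℕ) : Set where
  const : (r : ℚ) → 0ℚ ≤ r → LExp k
  var   : Fin k → LExp k
  scale : (r : ℚ) → 0ℚ ≤ r → LExp k → LExp k
  plus  : LExp k → LExp k → LExp k
  monus : LExp k → LExp k → LExp k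

data ExtLExp (k : ℕ) : Set where
  fin : LExp k → ExtLExp k
  ∞   : ExtLExp k

data Guard (k : ℕ) : Set where
  lt  : LExp k → LExp k → Guard k
  and : Guard k → Guard k → Guard k
  neg : Guard k → Guard k

data LinExp (k : ℕ) : Set where
  ext   : ExtLExp k → LinExp k
  guard : Guard k → LinExp k → LinExp k
  add   : LinExp k → LinExp k → LinExp k

data ℚ∞ : Set where
  val : ℚ → ℚ∞
  inf : ℚ∞

_+∞_ : ℚ∞ → ℚ∞ → ℚ∞
val a +∞ val b = val (a + b)
val _ +∞ inf   = inf
inf   +∞ _     = inf

⟦_⟧e : ∀ {k} → LExp k → State k → ℚ
⟦ const r _ ⟧e σ   = r
⟦ var x ⟧e σ       = (Data.Integer.+ σ x) / 1
⟦ scale r _ e ⟧e σ = r * ⟦ e ⟧e σ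
⟦ plus e f ⟧e σ    = ⟦ e ⟧e σ + ⟦ f ⟧e σ
⟦ monus e f ⟧e σ   = (⟦ e ⟧e σ - ⟦ f ⟧e σ) ⊔ 0ℚ

⟦_⟧x : ∀ {k} → ExtLExp k → State k → ℚ∞
⟦ fin e ⟧x σ = val (⟦ e ⟧e σ)
⟦ ∞ ⟧x σ     = inf

⟦_⟧g : ∀ {k} → Guard k → State k → Bool
⟦ lt e f ⟧g σ  = does (⟦ e ⟧e σ <? ⟦ f ⟧e σ)
⟦ and φ ψ ⟧g σ = ⟦ φ ⟧g σ ∧ ⟦ ψ ⟧g σ
⟦ neg φ ⟧g σ   = not (⟦ φ ⟧g σ)

-- [φ]·h : value of h if φ holds, 0 otherwise (so 0·∞ = 0)
⟦_⟧ : ∀ {k} → LinExp k → State k → ℚ∞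
⟦ ext e ⟧ σ     = ⟦ e ⟧x σ
⟦ guard φ h ⟧ σ = if ⟦ φ ⟧g σ then ⟦ h ⟧ σ else val 0ℚ
⟦ add h g ⟧ σ   = ⟦ h ⟧ σ +∞ ⟦ g ⟧ σ

_≐_ : ∀ {k} → LinExp k → LinExp k → Set
h ≐ h' = ∀ σ → ⟦ h ⟧ σ ≡ ⟦ h' ⟧ σ

guardedSum : ∀ {k m} → Vec (Guard k × ExtLExp k) (suc m) → LinExp k
guardedSum ((φ , e) ∷ [])         = guard φ (ext e)
guardedSum ((φ , e) ∷ (p ∷ ps))   = add (guard φ (ext e)) (guardedSum (p ∷ ps))

IsGNF : ∀ {k} → LinExp k → Set
IsGNF {k} h =
  Σ ℕ λ m → Σ (Vec (Guard k × ExtLExp k) (suc m)) λ v →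
    (h ≡ guardedSum v) ×
    (∀ (σ : State k) → ∃[ i ] ((⟦ proj₁ (lookup v i) ⟧g σ ≡ true) ×
        (∀ j → ⟦ proj₁ (lookup v j) ⟧g σ ≡ true → j ≡ i)))

{-# OPTIONS --safe #-}
-- Represent a linear expectation by a list of clauses (φᵢ , ẽᵢ) such that at every state
-- exactly one guard holds and the selected ẽᵢ is the value of the expectation.  A bare ẽ is
-- the clause (true , ẽ); [φ]·h conjoins φ to every clause of h and adds (¬φ , 0); h + g takes
-- all pairwise conjunctions of the clauses of h and g, adding their expressions.  Reading the
-- list back as a guarded sum gives the normal form.
module Submission where

open import Defs
open import Data.Nat using (ℕ)
open import Data.Fin using (zero; suc)
open import Data.Bool using (Bool; true; false; not)
open import Data.Product using (Σ; _×_; _,_; proj₁; ∃-syntax)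
open import Data.List using (List; []; _∷_; _++_; length; map)
open import Data.List.Relation.Unary.All using (All; []; _∷_)
open import Data.List.Relation.Unary.All.Properties using (++⁺)
open import Data.Vec using (fromList; lookup)
open import Data.Rational using (0ℚ)
open import Data.Rational.Properties using (≤-refl; <-irrefl; _<?_; +-identityˡ; +-identityʳ)
open import Data.Empty using (⊥; ⊥-elim)
open import Relation.Nullary using (yes; no)
open import Relation.Binary.PropositionalEquality using (_≡_; refl; sym; trans; cong; subst)

true≢false : ∀ {b : Bool} → b ≡ true → b ≡ false → ⊥
true≢false on off with () ← trans (sym on) off

Clause : ℕ → Set
Clause k = Guard k × ExtLExp k

module _ {k : ℕ} (σ : State k) where

  Off : Clause k → Set
  Off (φ , _) = ⟦ φ ⟧g σ ≡ false

  data Selects : List (Clause k) → ℚ∞ → Set where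
    here  : ∀ {φ e cs} → ⟦ φ ⟧g σ ≡ true → All Off cs → Selects ((φ , e) ∷ cs) (⟦ e ⟧x σ)
    there : ∀ {c cs v} → Off c → Selects cs v → Selects (c ∷ cs) v

  Selects-++ˡ : ∀ {cs ds v} → Selects cs v → All Off ds → Selects (cs ++ ds) v
  Selects-++ˡ (here on offs) ds-off = here on (++⁺ offs ds-off)
  Selects-++ˡ (there off sel) ds-off = there off (Selects-++ˡ sel ds-off)

  Selects-++ʳ : ∀ {cs ds v} → All Off cs → Selects ds v → Selects (cs ++ ds) v
  Selects-++ʳ [] sel = sel
  Selects-++ʳ (off ∷ offs) sel = there off (Selects-++ʳ offs sel)

  and-false : ∀ ψ χ → ⟦ ψ ⟧g σ ≡ false → ⟦ and ψ χ ⟧g σ ≡ false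
  and-false ψ χ ψ-off rewrite ψ-off = refl

  and-true : ∀ ψ χ → ⟦ ψ ⟧g σ ≡ true → ⟦ and ψ χ ⟧g σ ≡ ⟦ χ ⟧g σ
  and-true ψ χ ψ-on rewrite ψ-on = refl

zeroL : ∀ {k} → LExp k
zeroL = const 0ℚ ≤-refl

trueG : ∀ {k} → Guard k
trueG = neg (lt zeroL zeroL)

⟦trueG⟧ : ∀ {k} (σ : State k) → ⟦ trueG ⟧g σ ≡ true
⟦trueG⟧ σ with 0ℚ <? 0ℚ
... | yes 0<0 = ⊥-elim (<-irrefl refl 0<0)
... | no _    = refl

_⊕_ : ∀ {k} → ExtLExp k → ExtLExp k → ExtLExp k
fin a ⊕ fin b = fin (plus a b)
fin _ ⊕ ∞     = ∞
∞     ⊕ _     = ∞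

⟦⊕⟧ : ∀ {k} (a b : ExtLExp k) σ → ⟦ a ⊕ b ⟧x σ ≡ ⟦ a ⟧x σ +∞ ⟦ b ⟧x σ
⟦⊕⟧ (fin a) (fin b) σ = refl
⟦⊕⟧ (fin a) ∞       σ = refl
⟦⊕⟧ ∞       (fin b) σ = refl
⟦⊕⟧ ∞       ∞       σ = refl

conjoin : ∀ {k} → Guard k → (ExtLExp k → ExtLExp k) → List (Clause k) → List (Clause k)
conjoin ψ g = map (λ (χ , e) → and ψ χ , g e)

module _ {k : ℕ} (σ : State k) (ψ : Guard k) (g : ExtLExp k → ExtLExp k) where

  conjoin-off : ⟦ ψ ⟧g σ ≡ false → ∀ cs → All (Off σ) (conjoin ψ g cs)
  conjoin-off ψ-off [] = []
  conjoin-off ψ-off ((χ , _) ∷ cs) = and-false σ ψ χ ψ-off ∷ conjoin-off ψ-off cs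

  conjoin-allOff : ⟦ ψ ⟧g σ ≡ true → ∀ {cs} → All (Off σ) cs → All (Off σ) (conjoin ψ g cs)
  conjoin-allOff ψ-on {[]} [] = []
  conjoin-allOff ψ-on {(χ , _) ∷ _} (off ∷ offs) =
    trans (and-true σ ψ χ ψ-on) off ∷ conjoin-allOff ψ-on offs

  conjoin-selects : {G : ℚ∞ → ℚ∞} → (∀ e → ⟦ g e ⟧x σ ≡ G (⟦ e ⟧x σ)) →
                    ⟦ ψ ⟧g σ ≡ true → ∀ {cs v} → Selects σ cs v → Selects σ (conjoin ψ g cs) (G v)
  conjoin-selects ⟦g⟧ ψ-on (here {φ} {e} on offs) =
    subst (Selects σ _) (⟦g⟧ e) (here (trans (and-true σ ψ φ ψ-on) on) (conjoin-allOff ψ-on offs))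
  conjoin-selects ⟦g⟧ ψ-on (there {χ , _} off sel) =
    there (trans (and-true σ ψ χ ψ-on) off) (conjoin-selects ⟦g⟧ ψ-on sel)

restrict : ∀ {k} → Guard k → List (Clause k) → List (Clause k)
restrict φ = conjoin φ (λ e → e)

product : ∀ {k} → List (Clause k) → List (Clause k) → List (Clause k)
product []             ds = []
product ((ψ , e) ∷ cs) ds = conjoin ψ (e ⊕_) ds ++ product cs ds

module _ {k : ℕ} (σ : State k) where

  product-off : ∀ {cs} → All (Off σ) cs → ∀ ds → All (Off σ) (product cs ds)
  product-off [] ds = []
  product-off (off ∷ offs) ds = ++⁺ (conjoin-off σ _ _ off ds) (product-off offs ds)

  product-selects : ∀ {cs ds v w} → Selects σ cs v → Selects σ ds w → Selects σ (product cs ds) (v +∞ w)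
  product-selects {ds = ds} (here {e = e} on offs) sel =
    Selects-++ˡ σ (conjoin-selects σ _ (e ⊕_) (λ f → ⟦⊕⟧ e f σ) on sel) (product-off offs ds)
  product-selects {ds = ds} (there off sel₁) sel₂ =
    Selects-++ʳ σ (conjoin-off σ _ _ off ds) (product-selects sel₁ sel₂)

clauses : ∀ {k} → LinExp k → List (Clause k)
clauses (ext e)     = (trueG , e) ∷ []
clauses (guard φ h) = restrict φ (clauses h) ++ (neg φ , fin zeroL) ∷ []
clauses (add h g)   = product (clauses h) (clauses g)

clauses-selects : ∀ {k} (h : LinExp k) σ → Selects σ (clauses h) (⟦ h ⟧ σ)
clauses-selects (ext e) σ = here (⟦trueG⟧ σ) []
clauses-selects (guard φ h) σ with ⟦ φ ⟧g σ in φ≡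
... | true  = Selects-++ˡ σ (conjoin-selects σ φ (λ e → e) {G = λ v → v} (λ _ → refl) φ≡ (clauses-selects h σ))
                            (cong not φ≡ ∷ [])
... | false = Selects-++ʳ σ (conjoin-off σ φ _ φ≡ (clauses h)) (here (cong not φ≡) [])
clauses-selects (add h g) σ = product-selects σ (clauses-selects h σ) (clauses-selects g σ)

+∞-identityˡ : ∀ x → val 0ℚ +∞ x ≡ x
+∞-identityˡ (val a) = cong val (+-identityˡ a)
+∞-identityˡ inf     = refl

+∞-identityʳ : ∀ x → x +∞ val 0ℚ ≡ x
+∞-identityʳ (val a) = cong val (+-identityʳ a)
+∞-identityʳ inf     = refl

module _ {k : ℕ} (σ : State k) where

  ⟦guardedSum⟧-off : ∀ c cs → All (Off σ) (c ∷ cs) → ⟦ guardedSum (fromList (c ∷ cs)) ⟧ σ ≡ val 0ℚ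
  ⟦guardedSum⟧-off c []       (off ∷ []) rewrite off = refl
  ⟦guardedSum⟧-off c (d ∷ cs) (off ∷ offs)
    rewrite off | ⟦guardedSum⟧-off d cs offs = +∞-identityˡ (val 0ℚ)

  ⟦guardedSum⟧-selects : ∀ c cs {v} → Selects σ (c ∷ cs) v → ⟦ guardedSum (fromList (c ∷ cs)) ⟧ σ ≡ v
  ⟦guardedSum⟧-selects c []       (here on _) rewrite on = refl
  ⟦guardedSum⟧-selects c (d ∷ cs) (here on offs)
    rewrite on | ⟦guardedSum⟧-off d cs offs = +∞-identityʳ _
  ⟦guardedSum⟧-selects c (d ∷ cs) (there off sel)
    rewrite off | ⟦guardedSum⟧-selects d cs sel = +∞-identityˡ _

  lookup-off : ∀ {cs} → All (Off σ) cs → ∀ j → ⟦ proj₁ (lookup (fromList cs) j) ⟧g σ ≡ false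
  lookup-off (off ∷ _)    zero    = off
  lookup-off (_ ∷ offs) (suc j) = lookup-off offs j

  selects⇒uniqueTrueGuard : ∀ {cs v} → Selects σ cs v →
    ∃[ i ] ((⟦ proj₁ (lookup (fromList cs) i) ⟧g σ ≡ true) ×
           (∀ j → ⟦ proj₁ (lookup (fromList cs) j) ⟧g σ ≡ true → j ≡ i))
  selects⇒uniqueTrueGuard (here on offs) = zero , on , unique
    where
    unique : ∀ j → _ → j ≡ zero
    unique zero    _   = refl
    unique (suc j) onⱼ = ⊥-elim (true≢false onⱼ (lookup-off offs j))
  selects⇒uniqueTrueGuard (there off sel) with selects⇒uniqueTrueGuard sel
  ... | i , onᵢ , uniqueᵢ = suc i , onᵢ , unique
    where
    unique : ∀ j → _ → j ≡ suc i
    unique zero    on₀ = ⊥-elim (true≢false on₀ off)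
    unique (suc j) onⱼ = cong suc (uniqueᵢ j onⱼ)

-- The empty list never selects, so the junk value at [] is never reached.
fromClauses : ∀ {k} → List (Clause k) → LinExp k
fromClauses []       = ext ∞
fromClauses (c ∷ cs) = guardedSum (fromList (c ∷ cs))

fromClauses-GNF : ∀ {k} (h : LinExp k) cs → (∀ σ → Selects σ cs (⟦ h ⟧ σ)) →
                  IsGNF (fromClauses cs) × (fromClauses cs ≐ h)
fromClauses-GNF h [] sel with () ← sel (λ _ → 0)
fromClauses-GNF h (c ∷ cs) sel =
  (length cs , fromList (c ∷ cs) , refl , λ σ → selects⇒uniqueTrueGuard σ (sel σ)) ,
  λ σ → ⟦guardedSum⟧-selects σ c cs (sel σ)

lemma3 : (k : ℕ) → Σ (LinExp k → LinExp k) λ GNF → ∀ h → IsGNF (GNF h) × (GNF h ≐ h)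
lemma3 k = (λ h → fromClauses (clauses h)) , λ h → fromClauses-GNF h (clauses h) (clauses-selects h)
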